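{- If $G$ and $H$ are connected graphs, then (i) $\mu(G\,\square\, H) \le \min\{\mu(G)\,n(H),\ \mu(H)\,n(G)\}$, and (ii) $\mu(G\,\square\, H) \ge \max\{\mu(G)\,\mu_i(H),\ \mu(H)\,\mu_i(G)\}$.
   Context: All graphs are finite, simple, undirected and connected; $n(G)=|V(G)|$. For $X\subseteq V(G)$, two vertices $x,y\in X$ are $X$-visible if there is a shortest $x,y$-path $P$ in $G$ with $V(P)\cap X=\{x,y\}$; $X$ is a mutual-visibility set if all pairs of its vertices are $X$-visible. $\mu(G)$ is the largest size of a mutual-visibility set of $G$. A mutual-visibility set $X$ is independent if no two vertices of $X$ are adjacent; $\mu_i(G)$ is the largest size of an independent mutual-visibility set. The Cartesian product $G\,\square\, H$ has vertex set $V(G)\times V(H)$, with $(g,h)(g',h')$ an edge iff either $gg'\in E(G)$ and $h=h'$, or $g=g'$ and $hh'\in E(H)$. -}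

module Defs where

open import Data.Nat using (ℕ; zero; suc; _+_; _*_; _≤_)
open import Data.Fin using (Fin; remQuot)
open import Data.Fin.Subset using (Subset; _∈_; ∣_∣)
open import Data.List using (List; []; _∷_)
import Data.List.Membership.Propositional as LM
open import Data.Product using (Σ; _×_; _,_; proj₁; proj₂; ∃)
open import Data.Sum using (_⊎_)
open import Relation.Binary.PropositionalEquality using (_≡_)
open import Relation.Nullary using (¬_)

record Graph : Set₁ where
  field
    n   : ℕ
    Adj : Fin n → Fin n → Set

open Graph public

order : Graph → ℕ
order G = n G

IsSimple : Graph → Set
IsSimple G = (∀ x y → Adj G x y → Adj G y x) × (∀ x → ¬ Adj G x x)

data Walk (G : Graph) : Fin (n G) → Fin (n G) → Set where
  nil  : ∀ x → Walk G x x
  cons : ∀ {x y z} → Adj G x y → Walk G y z → Walk G x z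

len : ∀ {G x y} → Walk G x y → ℕ
len (nil _) = 0
len (cons _ w) = suc (len w)

verts : ∀ {G x y} → Walk G x y → List (Fin (n G))
verts (nil x) = x ∷ []
verts (cons {x = x} _ w) = x ∷ verts w

IsConnected : Graph → Set
IsConnected G = ∀ x y → Walk G x y

-- a shortest x,y-path: a walk of minimum length among all x,y-walks
-- (a minimum-length walk is necessarily a path)
IsShortest : ∀ {G x y} → Walk G x y → Set
IsShortest {G} {x} {y} P = ∀ (Q : Walk G x y) → len P ≤ len Q

Visible : (G : Graph) → Subset (n G) → Fin (n G) → Fin (n G) → Set
Visible G X x y =
  Σ (Walk G x y) λ P → IsShortest P ×
    (∀ v → v LM.∈ verts P → v ∈ X → (v ≡ x ⊎ v ≡ y))

IsMutualVisibility : (G : Graph) → Subset (n G) → Set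
IsMutualVisibility G X = ∀ x y → x ∈ X → y ∈ X → Visible G X x y

IsIndependent : (G : Graph) → Subset (n G) → Set
IsIndependent G X = ∀ x y → x ∈ X → y ∈ X → ¬ Adj G x y

IsIndependentMutualVisibility : (G : Graph) → Subset (n G) → Set
IsIndependentMutualVisibility G X = IsIndependent G X × IsMutualVisibility G X

IsMaxSize : ∀ {m} → (Subset m → Set) → ℕ → Set
IsMaxSize {m} P k = (Σ (Subset m) λ X → P X × ∣ X ∣ ≡ k) × (∀ X → P X → ∣ X ∣ ≤ k)

IsMu : Graph → ℕ → Set
IsMu G k = IsMaxSize (IsMutualVisibility G) k

IsMuI : Graph → ℕ → Set
IsMuI G k = IsMaxSize (IsIndependentMutualVisibility G) k

-- Cartesian product G □ H, vertex set Fin (n G * n H) ≅ Fin (n G) × Fin (n H)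
-- via remQuot / combine.
_□_ : Graph → Graph → Graph
G □ H = record
  { n = n G * n H
  ; Adj = λ u v →
      let g  = proj₁ (remQuot {n G} (n H) u) ; h  = proj₂ (remQuot {n G} (n H) u)
          g' = proj₁ (remQuot {n G} (n H) v) ; h' = proj₂ (remQuot {n G} (n H) v)
      in (Adj G g g' × h ≡ h') ⊎ (g ≡ g' × Adj H h h')
  }

-- (i) A shortest path between two vertices of one G-layer of G □ H never leaves that layer and
-- projects to a shortest path of G, so every G-layer of a mutual-visibility set X of G □ H is a
-- mutual-visibility set of G; summing over the n(H) layers gives |X| ≤ μ(G) n(H).
-- (ii) If A is a mutual-visibility set of G and B an independent one of H, then A × B is a
-- mutual-visibility set of G □ H: (g,h) and (g',h') are joined by a walk of length
-- d(g,g') + d(h,h'), the distance in G □ H, that takes one step along a shortest h,h'-path Q,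
-- then follows an A-avoiding shortest g,g'-path inside that G-layer, and finally the rest of Q.
-- The other halves of (i) and (ii) follow from G □ H ≅ H □ G.

module Submission where

open import Defs
open import Data.Nat using (ℕ; zero; suc; _+_; _*_; _≤_; z≤n; _⊓_; _⊔_)
open import Data.Nat.Properties
open import Data.Bool using (Bool; true; false; _∧_; if_then_else_)
open import Data.Fin using (Fin; zero; suc; combine; quotient; remainder; _↑ˡ_; _↑ʳ_)
open import Data.Fin.Properties using (remQuot-combine; combine-remQuot)
open import Data.Fin.Subset using (Subset; _∈_; ∣_∣; _∩_)
open import Data.Fin.Subset.Properties using (p∩q⊆p; p∩q⊆q)
open import Data.Vec using ([]; _∷_; lookup; tabulate)
open import Data.Vec.Properties using (lookup∘tabulate; lookup-zipWith; []=⇒lookup; lookup⇒[]=)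
open import Data.List.Relation.Unary.Any using (here; there)
import Data.List.Membership.Propositional as List
open import Data.Product using (Σ; ∃; _×_; _,_; proj₁; proj₂)
open import Data.Sum using (_⊎_; inj₁; inj₂)
open import Data.Empty using (⊥-elim)
open import Relation.Nullary using (¬_)
open import Relation.Binary.PropositionalEquality
open import Function using (_∘_)
open import Algebra.Properties.Semiring.Sum +-*-semiring
  using (sum; sum-syntax; sum-cong-≗; ∑-comm; *-distribˡ-sum; *-distribʳ-sum)

-- Finite sums and cardinalities

sum-split : ∀ {a b} (f : Fin (a + b) → ℕ) →
  sum f ≡ ∑[ i < a ] f (i ↑ˡ b) + ∑[ j < b ] f (a ↑ʳ j)
sum-split {zero} f = refl
sum-split {suc a} {b} f = trans (cong (f zero +_) (sum-split {a} {b} (f ∘ suc))) (sym (+-assoc (f zero) _ _))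

sum-combine : ∀ {m k} (f : Fin (m * k) → ℕ) →
  sum f ≡ ∑[ i < m ] ∑[ j < k ] f (combine i j)
sum-combine {zero} f = refl
sum-combine {suc m} {k} f =
  trans (sum-split {k} f) (cong (∑[ j < k ] f (j ↑ˡ (m * k)) +_) (sum-combine {m} {k} (f ∘ (k ↑ʳ_))))

sum-≤-* : ∀ {m} (f : Fin m → ℕ) {c} → (∀ i → f i ≤ c) → sum f ≤ m * c
sum-≤-* {zero} f f≤c = z≤n
sum-≤-* {suc m} f f≤c = +-mono-≤ (f≤c zero) (sum-≤-* (f ∘ suc) (f≤c ∘ suc))

indicator : Bool → ℕ
indicator b = if b then 1 else 0

indicator-∧ : ∀ a b → indicator (a ∧ b) ≡ indicator a * indicator b
indicator-∧ true b = sym (+-identityʳ (indicator b))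
indicator-∧ false b = refl

χ : ∀ {m} → Subset m → Fin m → ℕ
χ p i = indicator (lookup p i)

∣p∣≡∑χ : ∀ {m} (p : Subset m) → ∣ p ∣ ≡ sum (χ p)
∣p∣≡∑χ [] = refl
∣p∣≡∑χ (true ∷ p) = cong suc (∣p∣≡∑χ p)
∣p∣≡∑χ (false ∷ p) = ∣p∣≡∑χ p

χ-∩ : ∀ {m} (p q : Subset m) i → χ (p ∩ q) i ≡ χ p i * χ q i
χ-∩ p q i = trans (cong indicator (lookup-zipWith _∧_ i p q)) (indicator-∧ (lookup p i) (lookup q i))

preimage : ∀ {a b} → (Fin a → Fin b) → Subset b → Subset a
preimage f X = tabulate (λ i → lookup X (f i))

χ-preimage : ∀ {a b} (f : Fin a → Fin b) X i → χ (preimage f X) i ≡ χ X (f i)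
χ-preimage f X i = cong indicator (lookup∘tabulate (λ i → lookup X (f i)) i)

∈-preimage⁻ : ∀ {a b} {f : Fin a → Fin b} {X i} → i ∈ preimage f X → f i ∈ X
∈-preimage⁻ {f = f} {X} {i} i∈ =
  lookup⇒[]= (f i) X (trans (sym (lookup∘tabulate (λ i → lookup X (f i)) i)) ([]=⇒lookup i∈))

-- Walks

InteriorAvoids : ∀ {G x y} → Subset (n G) → Walk G x y → Set
InteriorAvoids {G} {x} {y} X P = ∀ v → v List.∈ verts P → v ∈ X → v ≡ x ⊎ v ≡ y

module _ {G : Graph} where

  castʷ : ∀ {x x' y y'} → x ≡ x' → y ≡ y' → Walk G x y → Walk G x' y'
  castʷ refl refl w = w

  len-castʷ : ∀ {x x' y y'} (e : x ≡ x') (e' : y ≡ y') w → len (castʷ e e' w) ≡ len w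
  len-castʷ refl refl w = refl

  verts-castʷ : ∀ {x x' y y'} (e : x ≡ x') (e' : y ≡ y') w → verts (castʷ e e' w) ≡ verts w
  verts-castʷ refl refl w = refl

  _++ʷ_ : ∀ {x y z} → Walk G x y → Walk G y z → Walk G x z
  nil _ ++ʷ w = w
  cons a v ++ʷ w = cons a (v ++ʷ w)

  len-++ʷ : ∀ {x y z} (v : Walk G x y) (w : Walk G y z) → len (v ++ʷ w) ≡ len v + len w
  len-++ʷ (nil _) w = refl
  len-++ʷ (cons a v) w = cong suc (len-++ʷ v w)

  ∈-verts-++ʷ⁻ : ∀ {x y z} (v : Walk G x y) (w : Walk G y z) {u} →
    u List.∈ verts (v ++ʷ w) → u List.∈ verts v ⊎ u List.∈ verts w
  ∈-verts-++ʷ⁻ (nil _) w u∈ = inj₂ u∈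
  ∈-verts-++ʷ⁻ (cons a v) w (here e) = inj₁ (here e)
  ∈-verts-++ʷ⁻ (cons a v) w (there u∈) with ∈-verts-++ʷ⁻ v w u∈
  ... | inj₁ u∈v = inj₁ (there u∈v)
  ... | inj₂ u∈w = inj₂ u∈w

  start∈verts : ∀ {x y} (w : Walk G x y) → x List.∈ verts w
  start∈verts (nil _) = here refl
  start∈verts (cons a w) = here refl

  suffixFrom : ∀ {x y} (w : Walk G x y) {v} → v List.∈ verts w → Σ (Walk G v y) λ s → len s ≤ len w
  suffixFrom (nil _) (here refl) = nil _ , z≤n
  suffixFrom (cons a w) (here refl) = cons a w , ≤-refl
  suffixFrom (cons a w) (there v∈) with suffixFrom w v∈
  ... | s , s≤w = s , m≤n⇒m≤1+n s≤w

  shortest⇒start∉tail : ∀ {x y z} (a : Adj G x y) (w : Walk G y z) →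
    IsShortest (cons a w) → ¬ x List.∈ verts w
  shortest⇒start∉tail a w shortest x∈w with suffixFrom w x∈w
  ... | s , s≤w = 1+n≰n (≤-trans (shortest s) s≤w)

module _ {G₁ G₂ : Graph} (f : Fin (n G₁) → Fin (n G₂))
         (f-adj : ∀ {a b} → Adj G₁ a b → Adj G₂ (f a) (f b)) where

  mapʷ : ∀ {x y} → Walk G₁ x y → Walk G₂ (f x) (f y)
  mapʷ (nil x) = nil (f x)
  mapʷ (cons a w) = cons (f-adj a) (mapʷ w)

  len-mapʷ : ∀ {x y} (w : Walk G₁ x y) → len (mapʷ w) ≡ len w
  len-mapʷ (nil _) = refl
  len-mapʷ (cons a w) = cong suc (len-mapʷ w)

  ∈-verts-mapʷ⁻ : ∀ {x y} (w : Walk G₁ x y) {v} → v List.∈ verts (mapʷ w) →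
    ∃ λ z → z List.∈ verts w × v ≡ f z
  ∈-verts-mapʷ⁻ (nil _) (here e) = _ , here refl , e
  ∈-verts-mapʷ⁻ (cons a w) (here e) = _ , here refl , e
  ∈-verts-mapʷ⁻ (cons a w) (there v∈) with ∈-verts-mapʷ⁻ w v∈
  ... | z , z∈ , e = z , there z∈ , e

-- Graph isomorphisms

record _≅_ (G₁ G₂ : Graph) : Set where
  field
    to       : Fin (n G₁) → Fin (n G₂)
    from     : Fin (n G₂) → Fin (n G₁)
    to-adj   : ∀ {a b} → Adj G₁ a b → Adj G₂ (to a) (to b)
    from-adj : ∀ {a b} → Adj G₂ a b → Adj G₁ (from a) (from b)
    from∘to  : ∀ x → from (to x) ≡ x
    to∘from  : ∀ y → to (from y) ≡ y

module _ {G₁ G₂ : Graph} (iso : G₁ ≅ G₂) where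
  open _≅_ iso

  visible-≅ : ∀ {X x x'} → Visible G₁ X x x' → Visible G₂ (preimage from X) (to x) (to x')
  visible-≅ {X} {x} {x'} (P , P-shortest , P-avoids) = mapʷ to to-adj P , shortest , avoids
    where
    shortest : IsShortest (mapʷ to to-adj P)
    shortest Q = begin
      len (mapʷ to to-adj P)    ≡⟨ len-mapʷ to to-adj P ⟩
      len P                     ≤⟨ P-shortest Q′ ⟩
      len Q′                    ≡⟨ len-castʷ (from∘to x) (from∘to x') (mapʷ from from-adj Q) ⟩
      len (mapʷ from from-adj Q) ≡⟨ len-mapʷ from from-adj Q ⟩
      len Q                     ∎
      where
      open ≤-Reasoning
      Q′ = castʷ (from∘to x) (from∘to x') (mapʷ from from-adj Q)
    avoids : InteriorAvoids (preimage from X) (mapʷ to to-adj P)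
    avoids v v∈ v∈X with ∈-verts-mapʷ⁻ to to-adj P v∈
    ... | z , z∈P , refl with P-avoids z z∈P (subst (_∈ X) (from∘to z) (∈-preimage⁻ v∈X))
    ... | inj₁ refl = inj₁ refl
    ... | inj₂ refl = inj₂ refl

  mutualVisibility-≅ : ∀ {X} → IsMutualVisibility G₁ X → IsMutualVisibility G₂ (preimage from X)
  mutualVisibility-≅ X-mv y y' y∈ y'∈ =
    subst₂ (Visible G₂ _) (to∘from y) (to∘from y')
      (visible-≅ (X-mv (from y) (from y') (∈-preimage⁻ y∈) (∈-preimage⁻ y'∈)))

-- The Cartesian product

module Product (G H : Graph) where

  ⟨_,_⟩ : Fin (n G) → Fin (n H) → Fin (n (G □ H))
  ⟨_,_⟩ = combine

  fstᵛ : Fin (n (G □ H)) → Fin (n G)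
  fstᵛ = quotient (n H)

  sndᵛ : Fin (n (G □ H)) → Fin (n H)
  sndᵛ = remainder {n G} (n H)

  fstᵛ-⟨⟩ : ∀ g h → fstᵛ ⟨ g , h ⟩ ≡ g
  fstᵛ-⟨⟩ g h = cong proj₁ (remQuot-combine g h)

  sndᵛ-⟨⟩ : ∀ g h → sndᵛ ⟨ g , h ⟩ ≡ h
  sndᵛ-⟨⟩ g h = cong proj₂ (remQuot-combine g h)

  ⟨fstᵛ,sndᵛ⟩ : ∀ u → ⟨ fstᵛ u , sndᵛ u ⟩ ≡ u
  ⟨fstᵛ,sndᵛ⟩ = combine-remQuot {n G} (n H)

  □-adjᴳ : ∀ h {g g'} → Adj G g g' → Adj (G □ H) ⟨ g , h ⟩ ⟨ g' , h ⟩
  □-adjᴳ h {g} {g'} a =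
    inj₁ ( subst₂ (Adj G) (sym (fstᵛ-⟨⟩ g h)) (sym (fstᵛ-⟨⟩ g' h)) a
         , trans (sndᵛ-⟨⟩ g h) (sym (sndᵛ-⟨⟩ g' h)) )

  □-adjᴴ : ∀ g {h h'} → Adj H h h' → Adj (G □ H) ⟨ g , h ⟩ ⟨ g , h' ⟩
  □-adjᴴ g {h} {h'} a =
    inj₂ ( trans (fstᵛ-⟨⟩ g h) (sym (fstᵛ-⟨⟩ g h'))
         , subst₂ (Adj H) (sym (sndᵛ-⟨⟩ g h)) (sym (sndᵛ-⟨⟩ g h')) a )

  liftᴳ : ∀ h {g g'} → Walk G g g' → Walk (G □ H) ⟨ g , h ⟩ ⟨ g' , h ⟩
  liftᴳ h = mapʷ (λ g → ⟨ g , h ⟩) (□-adjᴳ h)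

  liftᴴ : ∀ g {h h'} → Walk H h h' → Walk (G □ H) ⟨ g , h ⟩ ⟨ g , h' ⟩
  liftᴴ g = mapʷ (λ h → ⟨ g , h ⟩) (□-adjᴴ g)

  projᴳ : ∀ {u v} → Walk (G □ H) u v → Walk G (fstᵛ u) (fstᵛ v)
  projᴳ (nil u) = nil (fstᵛ u)
  projᴳ (cons (inj₁ (a , _)) w) = cons a (projᴳ w)
  projᴳ (cons (inj₂ (e , _)) w) = castʷ (sym e) refl (projᴳ w)

  projᴴ : ∀ {u v} → Walk (G □ H) u v → Walk H (sndᵛ u) (sndᵛ v)
  projᴴ (nil u) = nil (sndᵛ u)
  projᴴ (cons (inj₁ (_ , e)) w) = castʷ (sym e) refl (projᴴ w)
  projᴴ (cons (inj₂ (_ , a)) w) = cons a (projᴴ w)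

  len-projᴳ+len-projᴴ : ∀ {u v} (w : Walk (G □ H) u v) → len (projᴳ w) + len (projᴴ w) ≡ len w
  len-projᴳ+len-projᴴ (nil u) = refl
  len-projᴳ+len-projᴴ (cons (inj₁ (_ , e)) w)
    rewrite len-castʷ (sym e) refl (projᴴ w) = cong suc (len-projᴳ+len-projᴴ w)
  len-projᴳ+len-projᴴ (cons (inj₂ (e , _)) w)
    rewrite len-castʷ (sym e) refl (projᴳ w) | +-suc (len (projᴳ w)) (len (projᴴ w)) =
    cong suc (len-projᴳ+len-projᴴ w)

  ∈-verts-projᴳ⁻ : ∀ {u v} (w : Walk (G □ H) u v) {x} → x List.∈ verts (projᴳ w) →
    ∃ λ z → z List.∈ verts w × fstᵛ z ≡ x
  ∈-verts-projᴳ⁻ (nil u) (here refl) = u , here refl , refl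
  ∈-verts-projᴳ⁻ (cons (inj₁ _) w) (here refl) = _ , here refl , refl
  ∈-verts-projᴳ⁻ (cons (inj₁ _) w) (there x∈) with ∈-verts-projᴳ⁻ w x∈
  ... | z , z∈ , e = z , there z∈ , e
  ∈-verts-projᴳ⁻ (cons (inj₂ (e , _)) w) {x} x∈
    with ∈-verts-projᴳ⁻ w (subst (x List.∈_) (verts-castʷ (sym e) refl (projᴳ w)) x∈)
  ... | z , z∈ , e′ = z , there z∈ , e′

  projᴴ-empty⇒sndᵛ-constant : ∀ {u v} (w : Walk (G □ H) u v) → len (projᴴ w) ≡ 0 →
    ∀ {z} → z List.∈ verts w → sndᵛ z ≡ sndᵛ u
  projᴴ-empty⇒sndᵛ-constant (nil u) _ (here refl) = refl
  projᴴ-empty⇒sndᵛ-constant (cons (inj₁ _) w) _ (here refl) = refl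
  projᴴ-empty⇒sndᵛ-constant (cons (inj₁ (_ , e)) w) projᴴ≡0 (there z∈) =
    trans (projᴴ-empty⇒sndᵛ-constant w (trans (sym (len-castʷ (sym e) refl (projᴴ w))) projᴴ≡0) z∈) (sym e)
  projᴴ-empty⇒sndᵛ-constant (cons (inj₂ _) w) () _

  projᴳ⟨⟩ : ∀ {g g' h h'} → Walk (G □ H) ⟨ g , h ⟩ ⟨ g' , h' ⟩ → Walk G g g'
  projᴳ⟨⟩ {g} {g'} {h} {h'} w = castʷ (fstᵛ-⟨⟩ g h) (fstᵛ-⟨⟩ g' h') (projᴳ w)

  len-projᴳ⟨⟩ : ∀ {g g' h h'} (w : Walk (G □ H) ⟨ g , h ⟩ ⟨ g' , h' ⟩) → len (projᴳ⟨⟩ w) ≡ len (projᴳ w)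
  len-projᴳ⟨⟩ {g} {g'} {h} {h'} w = len-castʷ (fstᵛ-⟨⟩ g h) (fstᵛ-⟨⟩ g' h') (projᴳ w)

  projᴴ⟨⟩ : ∀ {g g' h h'} → Walk (G □ H) ⟨ g , h ⟩ ⟨ g' , h' ⟩ → Walk H h h'
  projᴴ⟨⟩ {g} {g'} {h} {h'} w = castʷ (sndᵛ-⟨⟩ g h) (sndᵛ-⟨⟩ g' h') (projᴴ w)

  len-projᴴ⟨⟩ : ∀ {g g' h h'} (w : Walk (G □ H) ⟨ g , h ⟩ ⟨ g' , h' ⟩) → len (projᴴ⟨⟩ w) ≡ len (projᴴ w)
  len-projᴴ⟨⟩ {g} {g'} {h} {h'} w = len-castʷ (sndᵛ-⟨⟩ g h) (sndᵛ-⟨⟩ g' h') (projᴴ w)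

  shortest-+-≤-len : ∀ {g g' h h'} {P : Walk G g g'} {Q : Walk H h h'} →
    IsShortest P → IsShortest Q → (W : Walk (G □ H) ⟨ g , h ⟩ ⟨ g' , h' ⟩) → len P + len Q ≤ len W
  shortest-+-≤-len {P = P} {Q} P-shortest Q-shortest W = begin
    len P + len Q                       ≤⟨ +-mono-≤ (P-shortest (projᴳ⟨⟩ W)) (Q-shortest (projᴴ⟨⟩ W)) ⟩
    len (projᴳ⟨⟩ W) + len (projᴴ⟨⟩ W) ≡⟨ cong₂ _+_ (len-projᴳ⟨⟩ W) (len-projᴴ⟨⟩ W) ⟩
    len (projᴳ W) + len (projᴴ W)       ≡⟨ len-projᴳ+len-projᴴ W ⟩
    len W                               ∎
    where open ≤-Reasoning

  module _ {g g' h} {W : Walk (G □ H) ⟨ g , h ⟩ ⟨ g' , h ⟩} (W-shortest : IsShortest W) where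

    len-≤-walksᴳ : (Q : Walk G g g') → len W ≤ len Q
    len-≤-walksᴳ Q = ≤-trans (W-shortest (liftᴳ h Q)) (≤-reflexive (len-mapʷ _ (□-adjᴳ h) Q))

    projᴳ⟨⟩-shortest : IsShortest (projᴳ⟨⟩ W)
    projᴳ⟨⟩-shortest Q = begin
      len (projᴳ⟨⟩ W)               ≡⟨ len-projᴳ⟨⟩ W ⟩
      len (projᴳ W)                 ≤⟨ m≤m+n (len (projᴳ W)) (len (projᴴ W)) ⟩
      len (projᴳ W) + len (projᴴ W) ≡⟨ len-projᴳ+len-projᴴ W ⟩
      len W                         ≤⟨ len-≤-walksᴳ Q ⟩
      len Q                         ∎
      where open ≤-Reasoning

    -- W is no longer than its G-projection, so it makes no step in the H-coordinate.
    projᴴ-shortest-empty : len (projᴴ W) ≡ 0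
    projᴴ-shortest-empty = n≤0⇒n≡0 (+-cancelˡ-≤ (len (projᴳ W)) _ 0 (begin
      len (projᴳ W) + len (projᴴ W) ≡⟨ len-projᴳ+len-projᴴ W ⟩
      len W                         ≤⟨ len-≤-walksᴳ (projᴳ⟨⟩ W) ⟩
      len (projᴳ⟨⟩ W)               ≡⟨ len-projᴳ⟨⟩ W ⟩
      len (projᴳ W)                 ≡⟨ +-identityʳ (len (projᴳ W)) ⟨
      len (projᴳ W) + 0             ∎))
      where open ≤-Reasoning

    shortest-stays-in-layerᴳ : ∀ {z} → z List.∈ verts W → z ≡ ⟨ fstᵛ z , h ⟩
    shortest-stays-in-layerᴳ {z} z∈W =
      trans (sym (⟨fstᵛ,sndᵛ⟩ z))
            (cong (λ h′ → ⟨ fstᵛ z , h′ ⟩) (trans (projᴴ-empty⇒sndᵛ-constant W projᴴ-shortest-empty z∈W) (sndᵛ-⟨⟩ g h)))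

  layerᴳ : Subset (n (G □ H)) → Fin (n H) → Subset (n G)
  layerᴳ X h = preimage (λ g → ⟨ g , h ⟩) X

  layerᴳ-mutualVisibility : ∀ {X} → IsMutualVisibility (G □ H) X → ∀ h → IsMutualVisibility G (layerᴳ X h)
  layerᴳ-mutualVisibility {X} X-mv h g g' g∈ g'∈
    with X-mv ⟨ g , h ⟩ ⟨ g' , h ⟩ (∈-preimage⁻ g∈) (∈-preimage⁻ g'∈)
  ... | W , W-shortest , W-avoids = projᴳ⟨⟩ W , projᴳ⟨⟩-shortest W-shortest , P-avoids
    where
    P-avoids : InteriorAvoids (layerᴳ X h) (projᴳ⟨⟩ W)
    P-avoids v v∈P v∈layer
      with ∈-verts-projᴳ⁻ W (subst (v List.∈_) (verts-castʷ (fstᵛ-⟨⟩ g h) (fstᵛ-⟨⟩ g' h) (projᴳ W)) v∈P)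
    ... | z , z∈W , refl
      with W-avoids z z∈W (subst (_∈ X) (sym (shortest-stays-in-layerᴳ W-shortest z∈W)) (∈-preimage⁻ v∈layer))
    ... | inj₁ refl = inj₁ (fstᵛ-⟨⟩ g h)
    ... | inj₂ refl = inj₂ (fstᵛ-⟨⟩ g' h)

  ∣∣≡∑∑χ : ∀ X → ∣ X ∣ ≡ ∑[ g < n G ] ∑[ h < n H ] χ X ⟨ g , h ⟩
  ∣∣≡∑∑χ X = trans (∣p∣≡∑χ X) (sum-combine {n G} {n H} (χ X))

  ∣∣≡∑∣layerᴳ∣ : ∀ X → ∣ X ∣ ≡ ∑[ h < n H ] ∣ layerᴳ X h ∣
  ∣∣≡∑∣layerᴳ∣ X = begin
    ∣ X ∣
      ≡⟨ ∣∣≡∑∑χ X ⟩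
    ∑[ g < n G ] ∑[ h < n H ] χ X ⟨ g , h ⟩
      ≡⟨ ∑-comm (λ g h → χ X ⟨ g , h ⟩) ⟩
    ∑[ h < n H ] ∑[ g < n G ] χ X ⟨ g , h ⟩
      ≡⟨ sum-cong-≗ (λ h → sum-cong-≗ (χ-preimage (λ g → ⟨ g , h ⟩) X)) ⟨
    ∑[ h < n H ] ∑[ g < n G ] χ (layerᴳ X h) g
      ≡⟨ sum-cong-≗ (λ h → ∣p∣≡∑χ (layerᴳ X h)) ⟨
    ∑[ h < n H ] ∣ layerᴳ X h ∣ ∎
    where open ≡-Reasoning

  mutualVisibility-≤-μ*n : ∀ {μ X} → IsMu G μ → IsMutualVisibility (G □ H) X → ∣ X ∣ ≤ μ * n H
  mutualVisibility-≤-μ*n {μ} {X} (_ , μ-max) X-mv = begin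
    ∣ X ∣                       ≡⟨ ∣∣≡∑∣layerᴳ∣ X ⟩
    ∑[ h < n H ] ∣ layerᴳ X h ∣ ≤⟨ sum-≤-* _ (λ h → μ-max (layerᴳ X h) (layerᴳ-mutualVisibility X-mv h)) ⟩
    n H * μ                     ≡⟨ *-comm (n H) μ ⟩
    μ * n H                     ∎
    where open ≤-Reasoning

  _⊠_ : Subset (n G) → Subset (n H) → Subset (n (G □ H))
  A ⊠ B = preimage fstᵛ A ∩ preimage sndᵛ B

  ∣⊠∣ : ∀ A B → ∣ A ⊠ B ∣ ≡ ∣ A ∣ * ∣ B ∣
  ∣⊠∣ A B = begin
    ∣ A ⊠ B ∣
      ≡⟨ ∣∣≡∑∑χ (A ⊠ B) ⟩
    ∑[ g < n G ] ∑[ h < n H ] χ (A ⊠ B) ⟨ g , h ⟩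
      ≡⟨ sum-cong-≗ (λ g → sum-cong-≗ (χ-⊠ g)) ⟩
    ∑[ g < n G ] ∑[ h < n H ] (χ A g * χ B h)
      ≡⟨ sum-cong-≗ (λ g → *-distribˡ-sum (χ A g) (χ B)) ⟨
    ∑[ g < n G ] (χ A g * sum (χ B))
      ≡⟨ *-distribʳ-sum (sum (χ B)) (χ A) ⟨
    sum (χ A) * sum (χ B)
      ≡⟨ cong₂ _*_ (∣p∣≡∑χ A) (∣p∣≡∑χ B) ⟨
    ∣ A ∣ * ∣ B ∣ ∎
    where
    open ≡-Reasoning
    χ-⊠ : ∀ g h → χ (A ⊠ B) ⟨ g , h ⟩ ≡ χ A g * χ B h
    χ-⊠ g h = begin
      χ (A ⊠ B) ⟨ g , h ⟩
        ≡⟨ χ-∩ (preimage fstᵛ A) (preimage sndᵛ B) ⟨ g , h ⟩ ⟩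
      χ (preimage fstᵛ A) ⟨ g , h ⟩ * χ (preimage sndᵛ B) ⟨ g , h ⟩
        ≡⟨ cong₂ _*_ (χ-preimage fstᵛ A _) (χ-preimage sndᵛ B _) ⟩
      χ A (fstᵛ ⟨ g , h ⟩) * χ B (sndᵛ ⟨ g , h ⟩)
        ≡⟨ cong₂ (λ g h → χ A g * χ B h) (fstᵛ-⟨⟩ g h) (sndᵛ-⟨⟩ g h) ⟩
      χ A g * χ B h ∎

  ∈-⊠⁻ : ∀ {A B g h} → ⟨ g , h ⟩ ∈ A ⊠ B → g ∈ A × h ∈ B
  ∈-⊠⁻ {A} {B} {g} {h} gh∈ =
    subst (_∈ A) (fstᵛ-⟨⟩ g h) (∈-preimage⁻ (p∩q⊆p (preimage fstᵛ A) (preimage sndᵛ B) gh∈)) ,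
    subst (_∈ B) (sndᵛ-⟨⟩ g h) (∈-preimage⁻ (p∩q⊆q (preimage fstᵛ A) (preimage sndᵛ B) gh∈))

  module _ {A : Subset (n G)} {B : Subset (n H)}
           (irreflexive : ∀ h → ¬ Adj H h h) (B-independent : IsIndependent H B) where

    -- For Q = h h₁ … h', the walk is (g,h) → (g,h₁), then P in the layer of h₁, then the rest of Q in the
    -- layer of g'. The layer of h₁ misses A ⊠ B because h₁ ∉ B (H is loopless and B independent),
    -- and the rest of Q misses h because Q is shortest.
    ⊠-avoidingWalk : ∀ {g g' h h'} → h ∈ B → h' ∈ B →
      (P : Walk G g g') → InteriorAvoids A P →
      (Q : Walk H h h') → IsShortest Q → InteriorAvoids B Q →
      Σ (Walk (G □ H) ⟨ g , h ⟩ ⟨ g' , h' ⟩) λ R → len R ≡ len P + len Q × InteriorAvoids (A ⊠ B) R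
    ⊠-avoidingWalk {g} {g'} {h} h∈ _ P P-avoids (nil _) _ _ =
      liftᴳ h P , trans (len-mapʷ _ (□-adjᴳ h) P) (sym (+-identityʳ (len P))) , R-avoids
      where
      R-avoids : InteriorAvoids (A ⊠ B) (liftᴳ h P)
      R-avoids z z∈R z∈A⊠B with ∈-verts-mapʷ⁻ _ (□-adjᴳ h) P z∈R
      ... | p , p∈P , refl with P-avoids p p∈P (proj₁ (∈-⊠⁻ {A} {B} z∈A⊠B))
      ... | inj₁ refl = inj₁ refl
      ... | inj₂ refl = inj₂ refl
    ⊠-avoidingWalk {g} {g'} {h} {h'} h∈ h'∈ P P-avoids (cons {y = h₁} a Q) Q-shortest Q-avoids =
      R , len-R , R-avoids
      where
      R = cons (□-adjᴴ g a) (liftᴳ h₁ P ++ʷ liftᴴ g' Q)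

      len-R : len R ≡ len P + suc (len Q)
      len-R = begin
        suc (len (liftᴳ h₁ P ++ʷ liftᴴ g' Q))
          ≡⟨ cong suc (len-++ʷ (liftᴳ h₁ P) (liftᴴ g' Q)) ⟩
        suc (len (liftᴳ h₁ P) + len (liftᴴ g' Q))
          ≡⟨ cong suc (cong₂ _+_ (len-mapʷ _ (□-adjᴳ h₁) P) (len-mapʷ _ (□-adjᴴ g') Q)) ⟩
        suc (len P + len Q)
          ≡⟨ +-suc (len P) (len Q) ⟨
        len P + suc (len Q) ∎
        where open ≡-Reasoning

      R-avoids : InteriorAvoids (A ⊠ B) R
      R-avoids z (here z≡start) _ = inj₁ z≡start
      R-avoids z (there z∈) z∈A⊠B with ∈-verts-++ʷ⁻ (liftᴳ h₁ P) (liftᴴ g' Q) z∈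
      ... | inj₁ z∈layer with ∈-verts-mapʷ⁻ _ (□-adjᴳ h₁) P z∈layer
      ...   | _ , _ , refl with Q-avoids h₁ (there (start∈verts Q)) (proj₂ (∈-⊠⁻ {A} {B} z∈A⊠B))
      ...     | inj₁ refl = ⊥-elim (irreflexive h a)
      ...     | inj₂ refl = ⊥-elim (B-independent h h' h∈ h'∈ a)
      R-avoids z (there z∈) z∈A⊠B | inj₂ z∈layer with ∈-verts-mapʷ⁻ _ (□-adjᴴ g') Q z∈layer
      ...   | q , q∈Q , refl with Q-avoids q (there q∈Q) (proj₂ (∈-⊠⁻ {A} {B} z∈A⊠B))
      ...     | inj₁ refl = ⊥-elim (shortest⇒start∉tail a Q Q-shortest q∈Q)
      ...     | inj₂ refl = inj₂ refl

    visible-⊠ : ∀ {g g' h h'} → h ∈ B → h' ∈ B →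
      Visible G A g g' → Visible H B h h' → Visible (G □ H) (A ⊠ B) ⟨ g , h ⟩ ⟨ g' , h' ⟩
    visible-⊠ h∈ h'∈ (P , P-shortest , P-avoids) (Q , Q-shortest , Q-avoids)
      with ⊠-avoidingWalk h∈ h'∈ P P-avoids Q Q-shortest Q-avoids
    ... | R , len-R , R-avoids =
      R , (λ W → ≤-trans (≤-reflexive len-R) (shortest-+-≤-len P-shortest Q-shortest W)) , R-avoids

    ⊠-mutualVisibility : IsMutualVisibility G A → IsMutualVisibility H B → IsMutualVisibility (G □ H) (A ⊠ B)
    ⊠-mutualVisibility A-mv B-mv u u' u∈ u'∈ =
      subst₂ (Visible (G □ H) (A ⊠ B)) (⟨fstᵛ,sndᵛ⟩ u) (⟨fstᵛ,sndᵛ⟩ u')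
        (visible-⊠ h∈ h'∈ (A-mv (fstᵛ u) (fstᵛ u') g∈ g'∈) (B-mv (sndᵛ u) (sndᵛ u') h∈ h'∈))
      where
      components : ∀ {v} → v ∈ A ⊠ B → fstᵛ v ∈ A × sndᵛ v ∈ B
      components {v} v∈ = ∈-⊠⁻ {A} {B} (subst (_∈ A ⊠ B) (sym (⟨fstᵛ,sndᵛ⟩ v)) v∈)
      g∈ = proj₁ (components u∈)
      h∈ = proj₂ (components u∈)
      g'∈ = proj₁ (components u'∈)
      h'∈ = proj₂ (components u'∈)

-- Commutativity of the Cartesian product

swapᵛ : ∀ G H → Fin (n (G □ H)) → Fin (n (H □ G))
swapᵛ G H u = HG.⟨ GH.sndᵛ u , GH.fstᵛ u ⟩
  where
  module GH = Product G H
  module HG = Product H G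

swapᵛ-⟨⟩ : ∀ G H g h → swapᵛ G H (Product.⟨_,_⟩ G H g h) ≡ Product.⟨_,_⟩ H G h g
swapᵛ-⟨⟩ G H g h = cong₂ (Product.⟨_,_⟩ H G) (Product.sndᵛ-⟨⟩ G H g h) (Product.fstᵛ-⟨⟩ G H g h)

swapᵛ-involutive : ∀ G H u → swapᵛ H G (swapᵛ G H u) ≡ u
swapᵛ-involutive G H u = trans (swapᵛ-⟨⟩ H G (GH.sndᵛ u) (GH.fstᵛ u)) (GH.⟨fstᵛ,sndᵛ⟩ u)
  where module GH = Product G H

swapᵛ-adj : ∀ G H {u v} → Adj (G □ H) u v → Adj (H □ G) (swapᵛ G H u) (swapᵛ G H v)
swapᵛ-adj G H {u} {v} (inj₁ (a , e)) =
  subst (λ h → Adj (H □ G) (swapᵛ G H u) HG.⟨ h , GH.fstᵛ v ⟩) e (HG.□-adjᴴ (GH.sndᵛ u) a)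
  where
  module GH = Product G H
  module HG = Product H G
swapᵛ-adj G H {u} {v} (inj₂ (e , a)) =
  subst (λ g → Adj (H □ G) (swapᵛ G H u) HG.⟨ GH.sndᵛ v , g ⟩) e (HG.□-adjᴳ (GH.fstᵛ u) a)
  where
  module GH = Product G H
  module HG = Product H G

□-comm : ∀ G H → (G □ H) ≅ (H □ G)
□-comm G H = record
  { to       = swapᵛ G H
  ; from     = swapᵛ H G
  ; to-adj   = swapᵛ-adj G H
  ; from-adj = swapᵛ-adj H G
  ; from∘to  = swapᵛ-involutive G H
  ; to∘from  = swapᵛ-involutive H G
  }

∣preimage-swapᵛ∣ : ∀ G H (X : Subset (n (G □ H))) → ∣ preimage (swapᵛ H G) X ∣ ≡ ∣ X ∣
∣preimage-swapᵛ∣ G H X = begin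
  ∣ preimage (swapᵛ H G) X ∣
    ≡⟨ HG.∣∣≡∑∑χ (preimage (swapᵛ H G) X) ⟩
  ∑[ h < n H ] ∑[ g < n G ] χ (preimage (swapᵛ H G) X) HG.⟨ h , g ⟩
    ≡⟨ sum-cong-≗ (λ h → sum-cong-≗ (χ-swap h)) ⟩
  ∑[ h < n H ] ∑[ g < n G ] χ X GH.⟨ g , h ⟩
    ≡⟨ ∑-comm (λ g h → χ X GH.⟨ g , h ⟩) ⟨
  ∑[ g < n G ] ∑[ h < n H ] χ X GH.⟨ g , h ⟩
    ≡⟨ GH.∣∣≡∑∑χ X ⟨
  ∣ X ∣ ∎
  where
  open ≡-Reasoning
  module GH = Product G H
  module HG = Product H G
  χ-swap : ∀ h g → χ (preimage (swapᵛ H G) X) HG.⟨ h , g ⟩ ≡ χ X GH.⟨ g , h ⟩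
  χ-swap h g = trans (χ-preimage (swapᵛ H G) X HG.⟨ h , g ⟩) (cong (χ X) (swapᵛ-⟨⟩ H G h g))

theorem3p2 : (G H : Graph) → IsSimple G → IsSimple H → IsConnected G → IsConnected H →
    ∀ {μG μH μiG μiH μGH : ℕ} → IsMu G μG → IsMu H μH → IsMuI G μiG → IsMuI H μiH →
    IsMu (G □ H) μGH →
    (μGH ≤ (μG * order H) ⊓ (μH * order G)) × ((μG * μiH) ⊔ (μH * μiG) ≤ μGH)
theorem3p2 G H (_ , G-irreflexive) (_ , H-irreflexive) _ _
  μG-max@((A , A-mv , refl) , _) μH-max@((B , B-mv , refl) , _)
  ((Aᵢ , (Aᵢ-independent , Aᵢ-mv) , refl) , _) ((Bᵢ , (Bᵢ-independent , Bᵢ-mv) , refl) , _)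
  ((X , X-mv , refl) , μGH-max) =
  ⊓-glb (GH.mutualVisibility-≤-μ*n μG-max X-mv)
        (subst (_≤ ∣ B ∣ * n G) (∣preimage-swapᵛ∣ G H X)
          (HG.mutualVisibility-≤-μ*n μH-max (mutualVisibility-≅ (□-comm G H) X-mv))) ,
  ⊔-lub (subst (_≤ ∣ X ∣) (GH.∣⊠∣ A Bᵢ)
          (μGH-max _ (GH.⊠-mutualVisibility H-irreflexive Bᵢ-independent A-mv Bᵢ-mv)))
        (subst (_≤ ∣ X ∣) (trans (∣preimage-swapᵛ∣ H G (B HG.⊠ Aᵢ)) (HG.∣⊠∣ B Aᵢ))
          (μGH-max _ (mutualVisibility-≅ (□-comm H G) (HG.⊠-mutualVisibility G-irreflexive Aᵢ-independent B-mv Aᵢ-mv))))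
  where
  module GH = Product G H
  module HG = Product H G
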